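{- Let $N=(N,\cdot)$ be a finite group, and suppose $N=M\times M'$ is the (internal) direct product of two subgroups $M,M'$. If $M$ is bad, then $N$ is bad.
   Context: A skew (left) brace is a set $B$ with two group operations $\cdot$ and $\circ$ such that $a\circ(b\cdot c)=(a\circ b)\cdot a^{ -1}\cdot(a\circ c)$ for all $a,b,c\in B$, where $a^{ -1}$ is the inverse of $a$ in $(B,\cdot)$. For $a\in B$, define $\gamma_a\colon B\to B$ by $\gamma_a(b)=a^{ -1}\cdot(a\circ b)$. A left ideal of $(B,\cdot,\circ)$ is a subgroup $I$ of $(B,\cdot)$ with $\gamma_a(I)\subseteq I$ for all $a\in B$. A finite group $(N,\cdot)$ is called good if for every group operation $\circ$ on $N$ such that $(N,\cdot,\circ)$ is a skew brace, every subgroup of $(N,\circ)$ is a left ideal of $(N,\cdot,\circ)$; it is called bad otherwise. -}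

module Defs where

open import Level using (0ℓ)
open import Data.Bool using (Bool; T)
open import Data.Bool.Properties using (T-irrelevant)
open import Data.Fin using (Fin)
open import Data.Nat using (ℕ)
open import Data.Product using (Σ; _×_; _,_; proj₁; proj₂; ∃-syntax)
open import Relation.Nullary using (¬_)
open import Relation.Binary.PropositionalEquality
open import Algebra.Structures using (IsGroup)
open import Algebra.Definitions

record GroupOn (A : Set) : Set where
  field
    _·_     : A → A → A
    ε       : A
    _⁻¹     : A → A
    isGroup : IsGroup _≡_ _·_ ε _⁻¹
  open IsGroup isGroup public using (assoc; identityˡ; identityʳ; inverseˡ; inverseʳ)

open GroupOn

-- (A, G, C) is a skew brace: G gives (A,·), C gives (A,∘).
IsSkewBrace : {A : Set} → GroupOn A → GroupOn A → Set
IsSkewBrace {A} G C =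
  ∀ (a b c : A) → _·_ C a (_·_ G b c) ≡ _·_ G (_·_ G (_·_ C a b) (_⁻¹ G a)) (_·_ C a c)

γ : {A : Set} → GroupOn A → GroupOn A → A → A → A
γ G C a b = _·_ G (_⁻¹ G a) (_·_ C a b)

IsSubgroup : {A : Set} → GroupOn A → (A → Set) → Set
IsSubgroup {A} G H =
  H (ε G) × (∀ x y → H x → H y → H (_·_ G x y)) × (∀ x → H x → H (_⁻¹ G x))

IsLeftIdeal : {A : Set} → GroupOn A → GroupOn A → (A → Set) → Set
IsLeftIdeal {A} G C H = IsSubgroup G H × (∀ a b → H b → H (γ G C a b))

Good : {A : Set} → GroupOn A → Set₁
Good {A} G = ∀ (C : GroupOn A) → IsSkewBrace G C →
  ∀ (H : A → Set) → IsSubgroup C H → IsLeftIdeal G C H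

Bad : {A : Set} → GroupOn A → Set₁
Bad G = ¬ Good G

Carrier : {n : ℕ} → (Fin n → Bool) → Set
Carrier {n} M = Σ (Fin n) (λ x → T (M x))

private
  Σ-≡ : {n : ℕ} {M : Fin n → Bool} {x y : Carrier M} → proj₁ x ≡ proj₁ y → x ≡ y
  Σ-≡ {x = x , p} {y = .x , q} refl = cong (x ,_) (T-irrelevant p q)

subgroupOn : {n : ℕ} (G : GroupOn (Fin n)) (M : Fin n → Bool) →
             IsSubgroup G (λ x → T (M x)) → GroupOn (Carrier M)
subgroupOn G M (e∈ , ·∈ , inv∈) = record
  { _·_ = λ x y → (_·_ G (proj₁ x) (proj₁ y) , ·∈ _ _ (proj₂ x) (proj₂ y))
  ; ε = (ε G , e∈)
  ; _⁻¹ = λ x → (_⁻¹ G (proj₁ x) , inv∈ _ (proj₂ x))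
  ; isGroup = record
    { isMonoid = record
      { isSemigroup = record
        { isMagma = record
          { isEquivalence = isEquivalence
          ; ∙-cong = λ { refl refl → refl } }
        ; assoc = λ x y z → Σ-≡ (assoc G (proj₁ x) (proj₁ y) (proj₁ z)) }
      ; identity = (λ x → Σ-≡ (identityˡ G (proj₁ x))) , (λ x → Σ-≡ (identityʳ G (proj₁ x))) }
    ; inverse = (λ x → Σ-≡ (inverseˡ G (proj₁ x))) , (λ x → Σ-≡ (inverseʳ G (proj₁ x)))
    ; ⁻¹-cong = λ { refl → refl } } }

IsNormalSubgroup : {A : Set} → GroupOn A → (A → Set) → Set
IsNormalSubgroup {A} G H =
  IsSubgroup G H × (∀ g x → H x → H (_·_ G (_·_ G g x) (_⁻¹ G g)))

IsInternalDirectProduct : {A : Set} → GroupOn A → (A → Set) → (A → Set) → Set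
IsInternalDirectProduct {A} G M M' =
  IsNormalSubgroup G M × IsNormalSubgroup G M' ×
  (∀ x → M x → M' x → x ≡ ε G) ×
  (∀ x → ∃[ m ] ∃[ m' ] (M m × M' m' × x ≡ _·_ G m m'))

-- Take a skew brace (M, ·, ∘) and a subgroup H of (M, ∘) that is not a left ideal.
-- Since N ≅ M × M', the product of this brace with the trivial brace (M', ·, ·) is a
-- skew brace on N; the preimage of H under the projection onto M is a subgroup of its
-- circle group, and pulling the left-ideal property back along m ↦ (m, 1) shows that
-- it is a left ideal only if H is one.  Goodness is carried across the isomorphism
-- by transporting skew brace structures along it.

module Submission where

open import Level using (0ℓ)
open import Algebra.Bundles using (Group)
import Algebra.Properties.Group as GroupProperties
open import Data.Bool using (Bool; T)
open import Data.Bool.Properties using (T-irrelevant)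
open import Data.Fin using (Fin)
open import Data.Nat using (ℕ)
open import Data.Product using (_×_; ∃-syntax; _,_; proj₁; proj₂)
open import Data.Product.Properties using (×-≡,≡→≡; Σ-≡,≡→≡)
open import Function using (_∘_)
open import Relation.Binary.PropositionalEquality
open import Relation.Unary using (_≐_)
open ≡-Reasoning

open import Defs

mkGroupOn : {A : Set} (_·_ : A → A → A) (ε : A) (_⁻¹ : A → A) →
            (∀ x y z → (x · y) · z ≡ x · (y · z)) →
            (∀ x → ε · x ≡ x) → (∀ x → x · ε ≡ x) →
            (∀ x → (x ⁻¹) · x ≡ ε) → (∀ x → x · (x ⁻¹) ≡ ε) → GroupOn A
mkGroupOn _·_ ε _⁻¹ assoc identityˡ identityʳ inverseˡ inverseʳ = record
  { _·_ = _·_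
  ; ε = ε
  ; _⁻¹ = _⁻¹
  ; isGroup = record
    { isMonoid = record
      { isSemigroup = record
        { isMagma = record { isEquivalence = isEquivalence ; ∙-cong = cong₂ _·_ }
        ; assoc = assoc }
      ; identity = identityˡ , identityʳ }
    ; inverse = inverseˡ , inverseʳ
    ; ⁻¹-cong = cong _⁻¹ } }

group : {A : Set} → GroupOn A → Group 0ℓ 0ℓ
group {A} G = record
  { Carrier = A ; _≈_ = _≡_ ; _∙_ = _·_ ; ε = ε ; _⁻¹ = _⁻¹ ; isGroup = isGroup }
  where open GroupOn G

record IsHomomorphism {A B : Set} (G : GroupOn A) (K : GroupOn B) (f : A → B) : Set where
  field
    homo : ∀ x y → f (GroupOn._·_ G x y) ≡ GroupOn._·_ K (f x) (f y)

module _ {A B : Set} {G : GroupOn A} {K : GroupOn B} {f : A → B}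
         (isHomo : IsHomomorphism G K f) where
  open IsHomomorphism isHomo
  private
    module G = GroupOn G
    module K = GroupOn K
    open GroupProperties (group K) using (identityˡ-unique; inverseˡ-unique)

  ε-homo : f G.ε ≡ K.ε
  ε-homo = identityˡ-unique (f G.ε) (f G.ε) (trans (sym (homo G.ε G.ε)) (cong f (G.identityˡ G.ε)))

  ⁻¹-homo : ∀ x → f (x G.⁻¹) ≡ f x K.⁻¹
  ⁻¹-homo x = inverseˡ-unique (f (x G.⁻¹)) (f x)
    (trans (sym (homo (x G.⁻¹) x)) (trans (cong f (G.inverseˡ x)) ε-homo))

  isSubgroup-preimage : {H : B → Set} → IsSubgroup K H → IsSubgroup G (H ∘ f)
  isSubgroup-preimage {H} (ε∈ , ·∈ , ⁻¹∈) =
      subst H (sym ε-homo) ε∈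
    , (λ x y x∈ y∈ → subst H (sym (homo x y)) (·∈ (f x) (f y) x∈ y∈))
    , (λ x x∈ → subst H (sym (⁻¹-homo x)) (⁻¹∈ (f x) x∈))

module _ {A B : Set} {G C : GroupOn A} {K D : GroupOn B} {f : A → B}
         (isHomo· : IsHomomorphism G K f) (isHomo∘ : IsHomomorphism C D f) where
  open IsHomomorphism isHomo· renaming (homo to homo·)
  open IsHomomorphism isHomo∘ renaming (homo to homo∘)
  private
    open module G = GroupOn G using (_·_; _⁻¹)
    open module C = GroupOn C using () renaming (_·_ to _∘ᶜ_)
    module K = GroupOn K
    open module D = GroupOn D using () renaming (_·_ to _∘ᴰ_)

  γ-homo : ∀ a b → f (γ G C a b) ≡ γ K D (f a) (f b)
  γ-homo a b = begin
    f ((a ⁻¹) · (a ∘ᶜ b))          ≡⟨ homo· (a ⁻¹) (a ∘ᶜ b) ⟩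
    K._·_ (f (a ⁻¹)) (f (a ∘ᶜ b))  ≡⟨ cong₂ K._·_ (⁻¹-homo isHomo· a) (homo∘ a b) ⟩
    K._·_ (f a K.⁻¹) (f a ∘ᴰ f b)  ∎

  isLeftIdeal-preimage : {H : B → Set} → IsLeftIdeal K D H → IsLeftIdeal G C (H ∘ f)
  isLeftIdeal-preimage {H} (H≤K , γ∈) =
    isSubgroup-preimage isHomo· H≤K , λ a b b∈ → subst H (sym (γ-homo a b)) (γ∈ (f a) (f b) b∈)

  isSkewBrace-reflect : (∀ {x y} → f x ≡ f y → x ≡ y) → IsSkewBrace K D → IsSkewBrace G C
  isSkewBrace-reflect f-injective brace a b c = f-injective (trans lhs (sym rhs))
    where
    lhs : f (a ∘ᶜ (b · c)) ≡ K._·_ (K._·_ (f a ∘ᴰ f b) (f a K.⁻¹)) (f a ∘ᴰ f c)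
    lhs = begin
      f (a ∘ᶜ (b · c))              ≡⟨ homo∘ a (b · c) ⟩
      f a ∘ᴰ f (b · c)              ≡⟨ cong (f a ∘ᴰ_) (homo· b c) ⟩
      f a ∘ᴰ (K._·_ (f b) (f c))    ≡⟨ brace (f a) (f b) (f c) ⟩
      K._·_ (K._·_ (f a ∘ᴰ f b) (f a K.⁻¹)) (f a ∘ᴰ f c) ∎
    rhs : f (((a ∘ᶜ b) · (a ⁻¹)) · (a ∘ᶜ c)) ≡ K._·_ (K._·_ (f a ∘ᴰ f b) (f a K.⁻¹)) (f a ∘ᴰ f c)
    rhs = begin
      f (((a ∘ᶜ b) · (a ⁻¹)) · (a ∘ᶜ c))                  ≡⟨ homo· ((a ∘ᶜ b) · (a ⁻¹)) (a ∘ᶜ c) ⟩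
      K._·_ (f ((a ∘ᶜ b) · (a ⁻¹))) (f (a ∘ᶜ c))          ≡⟨ cong₂ K._·_ (homo· (a ∘ᶜ b) (a ⁻¹)) (homo∘ a c) ⟩
      K._·_ (K._·_ (f (a ∘ᶜ b)) (f (a ⁻¹))) (f a ∘ᴰ f c)  ≡⟨ cong (λ u → K._·_ u (f a ∘ᴰ f c))
                                                              (cong₂ K._·_ (homo∘ a b) (⁻¹-homo isHomo· a)) ⟩
      K._·_ (K._·_ (f a ∘ᴰ f b) (f a K.⁻¹)) (f a ∘ᴰ f c)  ∎

isLeftIdeal-resp-≐ : {A : Set} {G C : GroupOn A} {P Q : A → Set} →
                     P ≐ Q → IsLeftIdeal G C P → IsLeftIdeal G C Q
isLeftIdeal-resp-≐ (P⊆Q , Q⊆P) ((ε∈ , ·∈ , ⁻¹∈) , γ∈) =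
    (P⊆Q ε∈ , (λ x y x∈ y∈ → P⊆Q (·∈ x y (Q⊆P x∈) (Q⊆P y∈))) , (λ x x∈ → P⊆Q (⁻¹∈ x (Q⊆P x∈))))
  , λ a b b∈ → P⊆Q (γ∈ a b (Q⊆P b∈))

trivial-isSkewBrace : {A : Set} (G : GroupOn A) → IsSkewBrace G G
trivial-isSkewBrace G a b c = begin
  a · (b · c)                   ≡⟨ assoc a b c ⟨
  (a · b) · c                   ≡⟨ cong ((a · b) ·_) (\\-leftDividesʳ a c) ⟨
  (a · b) · ((a ⁻¹) · (a · c))  ≡⟨ assoc (a · b) (a ⁻¹) (a · c) ⟨
  ((a · b) · (a ⁻¹)) · (a · c)  ∎
  where
  open GroupOn G
  open GroupProperties (group G) using (\\-leftDividesʳ)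

_×ᵍ_ : {A B : Set} → GroupOn A → GroupOn B → GroupOn (A × B)
G ×ᵍ K = mkGroupOn
  (λ x y → proj₁ x G.· proj₁ y , proj₂ x K.· proj₂ y)
  (G.ε , K.ε)
  (λ x → proj₁ x G.⁻¹ , proj₂ x K.⁻¹)
  (λ x y z → ×-≡,≡→≡ (G.assoc _ _ _ , K.assoc _ _ _))
  (λ x → ×-≡,≡→≡ (G.identityˡ _ , K.identityˡ _))
  (λ x → ×-≡,≡→≡ (G.identityʳ _ , K.identityʳ _))
  (λ x → ×-≡,≡→≡ (G.inverseˡ _ , K.inverseˡ _))
  (λ x → ×-≡,≡→≡ (G.inverseʳ _ , K.inverseʳ _))
  where
  module G = GroupOn G
  module K = GroupOn K

×-isSkewBrace : {A B : Set} {G C : GroupOn A} {K D : GroupOn B} →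
                IsSkewBrace G C → IsSkewBrace K D → IsSkewBrace (G ×ᵍ K) (C ×ᵍ D)
×-isSkewBrace braceˡ braceʳ (a , a') (b , b') (c , c') = ×-≡,≡→≡ (braceˡ a b c , braceʳ a' b' c')

module _ {A B : Set} (G : GroupOn A) (K : GroupOn B) where
  open GroupOn K using (ε; identityˡ)

  proj₁-isHomomorphism : IsHomomorphism (G ×ᵍ K) G proj₁
  proj₁-isHomomorphism = record { homo = λ _ _ → refl }

  _,ε-isHomomorphism : IsHomomorphism G (G ×ᵍ K) (_, ε)
  _,ε-isHomomorphism = record { homo = λ _ _ → cong (_ ,_) (sym (identityˡ ε)) }

Good-×ᵍ⇒Good : {A B : Set} {G : GroupOn A} (K : GroupOn B) → Good (G ×ᵍ K) → Good G
Good-×ᵍ⇒Good {G = G} K good C brace H H≤C =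
  isLeftIdeal-preimage (_,ε-isHomomorphism G K) (_,ε-isHomomorphism C K)
    (good (C ×ᵍ K) (×-isSkewBrace {G = G} {C} {K} {K} brace (trivial-isSkewBrace K))
          (H ∘ proj₁) (isSubgroup-preimage (proj₁-isHomomorphism C K) H≤C))

record _≅_ {A B : Set} (G : GroupOn A) (K : GroupOn B) : Set where
  field
    to             : A → B
    from           : B → A
    from∘to        : ∀ x → from (to x) ≡ x
    to∘from        : ∀ y → to (from y) ≡ y
    isHomomorphism : IsHomomorphism G K to

  to-injective : ∀ {x y} → to x ≡ to y → x ≡ y
  to-injective {x} {y} eq = begin
    x             ≡⟨ from∘to x ⟨
    from (to x)   ≡⟨ cong from eq ⟩
    from (to y)   ≡⟨ from∘to y ⟩
    y             ∎

  from-isHomomorphism : IsHomomorphism K G from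
  from-isHomomorphism = record { homo = λ x y → begin
    from (x K.· y)                         ≡⟨ cong from (cong₂ K._·_ (to∘from x) (to∘from y)) ⟨
    from (to (from x) K.· to (from y))     ≡⟨ cong from (IsHomomorphism.homo isHomomorphism (from x) (from y)) ⟨
    from (to (from x G.· from y))          ≡⟨ from∘to (from x G.· from y) ⟩
    from x G.· from y                      ∎ }
    where
    module G = GroupOn G
    module K = GroupOn K

  pullback : GroupOn B → GroupOn A
  pullback D = mkGroupOn
    (λ x y → from (to x D.· to y))
    (from D.ε)
    (λ x → from (to x D.⁻¹))
    (λ x y z → cong from (begin
      to (from (to x D.· to y)) D.· to z   ≡⟨ cong (D._· to z) (to∘from _) ⟩
      (to x D.· to y) D.· to z             ≡⟨ D.assoc (to x) (to y) (to z) ⟩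
      to x D.· (to y D.· to z)             ≡⟨ cong (to x D.·_) (to∘from _) ⟨
      to x D.· to (from (to y D.· to z))   ∎))
    (λ x → trans (cong from (trans (cong (D._· to x) (to∘from D.ε)) (D.identityˡ (to x)))) (from∘to x))
    (λ x → trans (cong from (trans (cong (to x D.·_) (to∘from D.ε)) (D.identityʳ (to x)))) (from∘to x))
    (λ x → cong from (trans (cong (D._· to x) (to∘from _)) (D.inverseˡ (to x))))
    (λ x → cong from (trans (cong (to x D.·_) (to∘from _)) (D.inverseʳ (to x))))
    where
    module D = GroupOn D

  to-isHomomorphism-pullback : (D : GroupOn B) → IsHomomorphism (pullback D) D to
  to-isHomomorphism-pullback D = record { homo = λ x y → to∘from _ }

  from-isHomomorphism-pullback : (D : GroupOn B) → IsHomomorphism D (pullback D) from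
  from-isHomomorphism-pullback D = record { homo = λ x y →
    cong from (sym (cong₂ (GroupOn._·_ D) (to∘from x) (to∘from y))) }

≅-sym : {A B : Set} {G : GroupOn A} {K : GroupOn B} → G ≅ K → K ≅ G
≅-sym iso = record
  { to = from ; from = to ; from∘to = to∘from ; to∘from = from∘to
  ; isHomomorphism = from-isHomomorphism }
  where open _≅_ iso

Good-resp-≅ : {A B : Set} {G : GroupOn A} {K : GroupOn B} → G ≅ K → Good G → Good K
Good-resp-≅ {K = K} iso good D brace H H≤D =
  isLeftIdeal-resp-≐ {G = K} {C = D} (subst H (to∘from _) , subst H (sym (to∘from _)))
    (isLeftIdeal-preimage from-isHomomorphism (from-isHomomorphism-pullback D)
      (good (pullback D)
            (isSkewBrace-reflect isHomomorphism (to-isHomomorphism-pullback D) to-injective brace)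
            (H ∘ to) (isSubgroup-preimage (to-isHomomorphism-pullback D) H≤D)))
  where open _≅_ iso

module InternalDirectProduct {A : Set} (G : GroupOn A) {M M' : A → Set}
                             (dp : IsInternalDirectProduct G M M') where
  open GroupOn G
  open GroupProperties (group G)
    using (x∙y⁻¹≈ε⇒x≈y; x≈z//y; y≈x\\z; inverseʳ-unique; ⁻¹-involutive)

  private
    ·-closedᴹ : ∀ x y → M x → M y → M (x · y)
    ·-closedᴹ = proj₁ (proj₂ (proj₁ (proj₁ dp)))
    ⁻¹-closedᴹ : ∀ x → M x → M (x ⁻¹)
    ⁻¹-closedᴹ = proj₂ (proj₂ (proj₁ (proj₁ dp)))
    conj-closedᴹ : ∀ g x → M x → M ((g · x) · (g ⁻¹))
    conj-closedᴹ = proj₂ (proj₁ dp)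
    ·-closedᴹ' : ∀ x y → M' x → M' y → M' (x · y)
    ·-closedᴹ' = proj₁ (proj₂ (proj₁ (proj₁ (proj₂ dp))))
    ⁻¹-closedᴹ' : ∀ x → M' x → M' (x ⁻¹)
    ⁻¹-closedᴹ' = proj₂ (proj₂ (proj₁ (proj₁ (proj₂ dp))))
    conj-closedᴹ' : ∀ g x → M' x → M' ((g · x) · (g ⁻¹))
    conj-closedᴹ' = proj₂ (proj₁ (proj₂ dp))
    M∩M'⊆ε : ∀ x → M x → M' x → x ≡ ε
    M∩M'⊆ε = proj₁ (proj₂ (proj₂ dp))

  commute : ∀ {m m'} → M m → M' m' → m · m' ≡ m' · m
  commute {m} {m'} m∈ m'∈ = begin
    m · m'            ≡⟨ x≈z//y (m · m') (m ⁻¹) m' (x∙y⁻¹≈ε⇒x≈y _ m' commutator≡ε) ⟩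
    m' · ((m ⁻¹) ⁻¹)  ≡⟨ cong (m' ·_) (⁻¹-involutive m) ⟩
    m' · m            ∎
    where
    -- Normality of M and of M' puts the commutator in M ∩ M'.
    commutator≡m·conj : ((m · m') · (m ⁻¹)) · (m' ⁻¹) ≡ m · ((m' · (m ⁻¹)) · (m' ⁻¹))
    commutator≡m·conj = trans (cong (_· (m' ⁻¹)) (assoc m m' (m ⁻¹))) (assoc m _ _)
    commutator≡ε : ((m · m') · (m ⁻¹)) · (m' ⁻¹) ≡ ε
    commutator≡ε = M∩M'⊆ε _
      (subst M (sym commutator≡m·conj) (·-closedᴹ _ _ m∈ (conj-closedᴹ m' (m ⁻¹) (⁻¹-closedᴹ m m∈))))
      (·-closedᴹ' _ _ (conj-closedᴹ' m m' m'∈) (⁻¹-closedᴹ' m' m'∈))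

  factorisation-unique : ∀ {m k m' k'} → M m → M k → M' m' → M' k' →
                         m · m' ≡ k · k' → m ≡ k × m' ≡ k'
  factorisation-unique {m} {k} {m'} {k'} m∈ k∈ m'∈ k'∈ eq = m≡k , m'≡k'
    where
    -- d = k⁻¹ m = k' m'⁻¹ lies in M ∩ M'.
    k'≡d·m' : k' ≡ ((k ⁻¹) · m) · m'
    k'≡d·m' = trans (y≈x\\z k k' (m · m') (sym eq)) (sym (assoc (k ⁻¹) m m'))
    d≡ε : (k ⁻¹) · m ≡ ε
    d≡ε = M∩M'⊆ε _ (·-closedᴹ _ _ (⁻¹-closedᴹ k k∈) m∈)
      (subst M' (sym (x≈z//y _ m' k' (sym k'≡d·m'))) (·-closedᴹ' _ _ k'∈ (⁻¹-closedᴹ' m' m'∈)))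
    m≡k : m ≡ k
    m≡k = trans (inverseʳ-unique (k ⁻¹) m d≡ε) (⁻¹-involutive k)
    m'≡k' : m' ≡ k'
    m'≡k' = sym (trans k'≡d·m' (trans (cong (_· m') d≡ε) (identityˡ m')))

  ·-interchange : ∀ {k m'} m k' → M k → M' m' → (m · k) · (m' · k') ≡ (m · m') · (k · k')
  ·-interchange {k} {m'} m k' k∈ m'∈ = begin
    (m · k) · (m' · k')   ≡⟨ assoc m k (m' · k') ⟩
    m · (k · (m' · k'))   ≡⟨ cong (m ·_) (assoc k m' k') ⟨
    m · ((k · m') · k')   ≡⟨ cong (λ u → m · (u · k')) (commute k∈ m'∈) ⟩
    m · ((m' · k) · k')   ≡⟨ cong (m ·_) (assoc m' k k') ⟩
    m · (m' · (k · k'))   ≡⟨ assoc m m' (k · k') ⟨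
    (m · m') · (k · k')   ∎

Carrier-≡ : {n : ℕ} {S : Fin n → Bool} {x y : Carrier S} → proj₁ x ≡ proj₁ y → x ≡ y
Carrier-≡ eq = Σ-≡,≡→≡ (eq , T-irrelevant _ _)

multiplication-≅ : {n : ℕ} (N : GroupOn (Fin n)) (M M' : Fin n → Bool) →
                   (dp : IsInternalDirectProduct N (λ x → T (M x)) (λ x → T (M' x))) →
                   (subgroupOn N M (proj₁ (proj₁ dp)) ×ᵍ subgroupOn N M' (proj₁ (proj₁ (proj₂ dp)))) ≅ N
multiplication-≅ {n} N M M' dp = record
  { to = λ (m , m') → proj₁ m · proj₁ m'
  ; from = from
  ; from∘to = λ (m , m') →
      let (k , k' , k∈ , k'∈ , mm'≡kk') = factorise (proj₁ m · proj₁ m')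
          (k≡m , k'≡m') = factorisation-unique k∈ (proj₂ m) k'∈ (proj₂ m') (sym mm'≡kk')
      in ×-≡,≡→≡ (Carrier-≡ k≡m , Carrier-≡ k'≡m')
  ; to∘from = λ x → sym (proj₂ (proj₂ (proj₂ (proj₂ (factorise x)))))
  ; isHomomorphism = record { homo = λ (m , m') (k , k') →
      ·-interchange (proj₁ m) (proj₁ k') (proj₂ k) (proj₂ m') }
  }
  where
  open GroupOn N
  open InternalDirectProduct N dp
  factorise : ∀ x → ∃[ m ] ∃[ m' ] (T (M m) × T (M' m') × x ≡ m · m')
  factorise = proj₂ (proj₂ (proj₂ dp))

  from : Fin n → Carrier M × Carrier M'
  from x = let (m , m' , m∈ , m'∈ , _) = factorise x in (m , m∈) , (m' , m'∈)

lemma2p8 : (n : ℕ) (N : GroupOn (Fin n)) (M M' : Fin n → Bool) →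
    (dp : IsInternalDirectProduct N (λ x → T (M x)) (λ x → T (M' x))) →
    Bad (subgroupOn N M (proj₁ (proj₁ dp))) →
    Bad N
lemma2p8 n N M M' dp M-bad N-good =
  M-bad (Good-×ᵍ⇒Good {G = Mᵍ} M'ᵍ (Good-resp-≅ (≅-sym (multiplication-≅ N M M' dp)) N-good))
  where
  Mᵍ : GroupOn (Carrier M)
  Mᵍ = subgroupOn N M (proj₁ (proj₁ dp))
  M'ᵍ : GroupOn (Carrier M')
  M'ᵍ = subgroupOn N M' (proj₁ (proj₁ (proj₂ dp)))
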